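{- Let $b,c_1,c_2$ be positive integers and let $\alpha/\beta$ be the right lobster $\mathcal{L}^{c_1,c_2}_b$, with $c_1$, $b$, $c_2$ cells in the top, middle and bottom rows respectively. Then $$\mathrm{inv}(S^{\mathrm{col}}_{\alpha/\beta})=c_1\bigl(b+\min\{c_1,c_2\}\bigr)+\binom{b}{2}+\binom{\max\{c_1,c_2\}}{2}.$$
   Context: The right lobster $\mathcal{L}^{c_1,c_2}_b$ is the skew diagram $\alpha/\beta$ with $\alpha=(b+1+c_2,b+1,b+1+c_1)$, $\beta=(b+1,1,b+1)$ (cells of the diagram of $\alpha$ not in that of $\beta$, diagrams with $\alpha_i$ left-justified cells in row $i$, rows numbered from the bottom): a top row of $c_1$ cells and a bottom row of $c_2$ cells, both starting at column $b+2$, and a middle row of $b$ cells in columns $2,\ldots,b+1$. Let $n=b+c_1+c_2$. $S^{\mathrm{col}}_{\alpha/\beta}$ is the filling of the cells with $1,\ldots,n$ consecutively along columns from bottom to top, starting with the leftmost column and moving right. The reading word of a tableau $T$ reads its entries from right to left along rows, from the top row to the bottom row; $\mathrm{inv}(T)$ is the number of pairs of positions $p<q$ in the reading word whose entries satisfy (entry at $p$) $>$ (entry at $q$). -}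

module Defs where

open import Data.Nat using (ℕ; zero; suc; _+_; _*_; _<ᵇ_; _≡ᵇ_; _≤ᵇ_; _⊔_)
open import Data.Bool using (Bool; true; false; if_then_else_; _∧_)
open import Data.List using (List; []; _∷_; _++_; length; filter; concatMap; reverse; map; foldr; applyUpTo)
open import Data.Product using (_×_; _,_)
open import Relation.Nullary.Decidable using (T?)

-- A partition / composition is a list of row lengths, rows numbered from
-- the bottom: the head of the list is row 1 (bottom row).
-- Rows and columns are 1-indexed; row i of the diagram of α consists of
-- the cells (i , j) with 1 ≤ j ≤ α_i.

rowLen : List ℕ → ℕ → ℕ
rowLen []       _             = 0
rowLen (a ∷ as) zero          = 0
rowLen (a ∷ as) (suc zero)    = a
rowLen (a ∷ as) (suc (suc i)) = rowLen as (suc i)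

Cell : Set
Cell = ℕ × ℕ   -- (row , column)

inSkew : List ℕ → List ℕ → Cell → Bool
inSkew α β (i , j) = (rowLen β i <ᵇ j) ∧ (j ≤ᵇ rowLen α i)

oneTo : ℕ → List ℕ
oneTo n = applyUpTo suc n

maxList : List ℕ → ℕ
maxList = foldr _⊔_ 0

columnOrder : List ℕ → List ℕ → List Cell
columnOrder α β =
  concatMap (λ j → filter (λ c → T? (inSkew α β c))
                         (map (λ i → (i , j)) (oneTo (length α))))
            (oneTo (maxList α))

readingOrder : List ℕ → List ℕ → List Cell
readingOrder α β =
  concatMap (λ i → filter (λ c → T? (inSkew α β c))
                         (map (λ j → (i , j)) (reverse (oneTo (maxList α)))))
            (reverse (oneTo (length α)))

cellEq : Cell → Cell → Bool
cellEq (i , j) (i' , j') = (i ≡ᵇ i') ∧ (j ≡ᵇ j')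

position : Cell → List Cell → ℕ
position c []       = 0
position c (d ∷ ds) = if cellEq c d then 1 else suc (position c ds)

Tableau : Set
Tableau = Cell → ℕ

Scol : List ℕ → List ℕ → Tableau
Scol α β c = position c (columnOrder α β)

readingWord : List ℕ → List ℕ → Tableau → List ℕ
readingWord α β T = map T (readingOrder α β)

inversions : List ℕ → ℕ
inversions []       = 0
inversions (x ∷ xs) = length (filter (λ y → T? (y <ᵇ x)) xs) + inversions xs

inv : List ℕ → List ℕ → Tableau → ℕ
inv α β T = inversions (readingWord α β T)

lobsterα : ℕ → ℕ → ℕ → List ℕ
lobsterα b c₁ c₂ = (suc b + c₂) ∷ suc b ∷ (suc b + c₁) ∷ []

lobsterβ : ℕ → List ℕ
lobsterβ b = suc b ∷ 1 ∷ suc b ∷ []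

-- Read top row first, each row right to left, the word of S^col consists of
-- three decreasing runs: the top row holds topEntry i = b + i + 1 + min(i + 1, c₂)
-- (i < c₁), the middle row holds 1, …, b, and the bottom row holds
-- bottomEntry i = b + i + 1 + min(i, c₁) (i < c₂); these values are read off from
-- the number of cells in the columns to the left of a cell. Each run has
-- C(length, 2) inversions, every top entry exceeds every middle entry, no middle
-- entry exceeds a bottom entry, and the top entry of index k exceeds exactly the
-- bottom entries of index i ≤ k. Hence
--   inv = C(c₁,2) + C(b,2) + C(c₂,2) + c₁ b + Σ_{k<c₁} min(k + 1, c₂),
-- and the last sum is c₁ min(c₁,c₂) + C(max(c₁,c₂),2) − C(c₁,2) − C(c₂,2).

module Submission where

open import Defs
open import Data.Bool using (Bool; true; false; T; if_then_else_; _∧_)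
open import Data.Bool.Properties using (T-≡; T-∧)
open import Data.List
  using (List; []; _∷_; [_]; _++_; length; filter; filterᵇ; concatMap; reverse; map; applyUpTo; applyDownFrom)
open import Data.List.Properties
  using (filter-++; filter-all; filter-none; ++-identityʳ; length-++; concatMap-++; applyUpTo-∷ʳ;
         reverse-applyUpTo; map-applyDownFrom; map-++)
open import Data.List.Membership.Propositional using (_∈_)
open import Data.List.Membership.Propositional.Properties using (∈-filter⁺; ∈-map⁺; ∈-applyUpTo⁺)
open import Data.List.Relation.Unary.All as All using (All; []; _∷_)
open import Data.List.Relation.Unary.All.Properties using (applyDownFrom⁺₁; applyUpTo⁺₁; applyUpTo⁺₂; concat⁺; map⁺; filter⁺)
open import Data.List.Relation.Unary.Any using (here; there)
open import Data.Nat using (ℕ; zero; suc; _+_; _*_; _≤_; _<_; _<ᵇ_; _≡ᵇ_; _⊓_; _⊔_; z≤n; s≤s)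
open import Data.Nat.Properties
open import Data.Nat.Combinatorics using (_C_; nC1≡n; nCk+nC[k+1]≡[n+1]C[k+1])
open import Data.Nat.Tactic.RingSolver using (solve-∀)
open import Data.Product using (_,_; proj₁; proj₂)
open import Data.Sum using (inj₁; inj₂)
open import Data.Unit using (tt)
open import Function using (_∘_)
open import Function.Bundles using (Equivalence)
open import Relation.Binary.PropositionalEquality using (_≡_; _≢_; refl; sym; trans; cong; cong₂; subst; module ≡-Reasoning)
open import Relation.Nullary using (contradiction)
open import Relation.Nullary.Decidable using (T?)

open Equivalence using (to; from)

toℕ : Bool → ℕ
toℕ false = 0
toℕ true  = 1

<ᵇ-true : ∀ {m n} → m < n → (m <ᵇ n) ≡ true
<ᵇ-true m<n = to T-≡ (<⇒<ᵇ m<n)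

<ᵇ-false : ∀ {m n} → n ≤ m → (m <ᵇ n) ≡ false
<ᵇ-false {m} {n} n≤m with m <ᵇ n in eq
... | false = refl
... | true  = contradiction (<ᵇ⇒< m n (subst T (sym eq) tt)) (≤⇒≯ n≤m)

+-cancelˡ-<ᵇ : ∀ m i n → (m + i <ᵇ m + n) ≡ (i <ᵇ n)
+-cancelˡ-<ᵇ zero    i n = refl
+-cancelˡ-<ᵇ (suc m) i n = +-cancelˡ-<ᵇ m i n

⊓-suc : ∀ i c → suc i ⊓ c ≡ i ⊓ c + toℕ (i <ᵇ c)
⊓-suc i       zero    = sym (trans (+-identityʳ (i ⊓ 0)) (⊓-zeroʳ i))
⊓-suc zero    (suc c) = refl
⊓-suc (suc i) (suc c) = cong suc (⊓-suc i c)

applyUpTo-+ : ∀ {A : Set} (f : ℕ → A) m n → applyUpTo f (m + suc n) ≡ applyUpTo f m ++ f m ∷ applyUpTo (λ k → f (suc (m + k))) n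
applyUpTo-+ f zero    n = refl
applyUpTo-+ f (suc m) n = cong (f 0 ∷_) (applyUpTo-+ (f ∘ suc) m n)

applyDownFrom-+ : ∀ {A : Set} (f : ℕ → A) m n → applyDownFrom f (m + n) ≡ applyDownFrom (λ i → f (m + i)) n ++ applyDownFrom f m
applyDownFrom-+ f m zero    rewrite +-identityʳ m = refl
applyDownFrom-+ f m (suc n) rewrite +-suc m n = cong (f (m + n) ∷_) (applyDownFrom-+ f m n)

applyDownFrom-cong : ∀ {A : Set} {f g : ℕ → A} n → (∀ {i} → i < n → f i ≡ g i) → applyDownFrom f n ≡ applyDownFrom g n
applyDownFrom-cong zero    f≗g = refl
applyDownFrom-cong (suc n) f≗g = cong₂ _∷_ (f≗g (n<1+n n)) (applyDownFrom-cong n (f≗g ∘ m<n⇒m<1+n))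

module _ {A : Set} (p : A → Bool) where

  filterᵇ-all : ∀ {xs} → All (λ x → p x ≡ true) xs → filterᵇ p xs ≡ xs
  filterᵇ-all = filter-all (T? ∘ p) ∘ All.map (λ e → subst T (sym e) tt)

  filterᵇ-none : ∀ {xs} → All (λ x → p x ≡ false) xs → filterᵇ p xs ≡ []
  filterᵇ-none = filter-none (T? ∘ p) ∘ All.map (λ e → subst T e)

  filterᵇ-cong : ∀ (q : A → Bool) xs → All (λ x → p x ≡ q x) xs → filterᵇ p xs ≡ filterᵇ q xs
  filterᵇ-cong q []       []       = refl
  filterᵇ-cong q (x ∷ xs) (e ∷ es) with p x | q x | e | filterᵇ-cong q xs es
  ... | true  | .true  | refl | ih = cong (x ∷_) ih
  ... | false | .false | refl | ih = ih

-- Cell (i , suc j) lies in a row occupying columns a + 2, …, a + 1 + n iff window a n j.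
window : ℕ → ℕ → ℕ → Bool
window a n j = (a <ᵇ j) ∧ (j <ᵇ suc a + n)

window-below : ∀ {a j} n → j ≤ a → window a n j ≡ false
window-below {a} {j} n j≤a = cong (_∧ (j <ᵇ suc a + n)) (<ᵇ-false j≤a)

window-shift : ∀ a n i → window a n (suc a + i) ≡ (i <ᵇ n)
window-shift a n i = trans (cong (_∧ (suc a + i <ᵇ suc a + n)) (<ᵇ-true (s≤s (m≤m+n a i)))) (+-cancelˡ-<ᵇ (suc a) i n)

window-inside : ∀ a {n i} → i < n → T (window a n (suc a + i))
window-inside a {n} {i} i<n = subst T (sym (window-shift a n i)) (<⇒<ᵇ i<n)

filterᵇ-window : ∀ {A : Set} (p : A → Bool) (f : ℕ → A) a n k → (∀ j → p (f j) ≡ window a n j) →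
  filterᵇ p (applyDownFrom f (suc a + n + k)) ≡ applyDownFrom (λ i → f (suc a + i)) n
filterᵇ-window {A} p f a n k p∘f≡window = begin
    filterᵇ p (applyDownFrom f (suc a + n + k))
  ≡⟨ cong (filterᵇ p) (applyDownFrom-+ f (suc a + n) k) ⟩
    filterᵇ p (right ++ applyDownFrom f (suc a + n))
  ≡⟨ cong (λ xs → filterᵇ p (right ++ xs)) (applyDownFrom-+ f (suc a) n) ⟩
    filterᵇ p (right ++ inside ++ left)
  ≡⟨ filter-++ (T? ∘ p) right (inside ++ left) ⟩
    filterᵇ p right ++ filterᵇ p (inside ++ left)
  ≡⟨ cong (filterᵇ p right ++_) (filter-++ (T? ∘ p) inside left) ⟩
    filterᵇ p right ++ filterᵇ p inside ++ filterᵇ p left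
  ≡⟨ cong₂ (λ xs ys → xs ++ filterᵇ p inside ++ ys) (filterᵇ-none p right-out) (filterᵇ-none p left-out) ⟩
    filterᵇ p inside ++ []
  ≡⟨ trans (++-identityʳ _) (filterᵇ-all p inside-in) ⟩
    inside ∎
  where
  open ≡-Reasoning
  right inside left : List A
  right  = applyDownFrom (λ i → f (suc a + n + i)) k
  inside = applyDownFrom (λ i → f (suc a + i)) n
  left   = applyDownFrom f (suc a)
  right-out : All (λ x → p x ≡ false) right
  right-out = applyDownFrom⁺₁ _ k λ {i} _ → begin
      p (f (suc a + n + i))         ≡⟨ p∘f≡window _ ⟩
      window a n (suc a + n + i)    ≡⟨ cong (window a n) (+-assoc (suc a) n i) ⟩
      window a n (suc a + (n + i))  ≡⟨ window-shift a n (n + i) ⟩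
      (n + i <ᵇ n)                  ≡⟨ <ᵇ-false (m≤m+n n i) ⟩
      false                         ∎
  inside-in : All (λ x → p x ≡ true) inside
  inside-in = applyDownFrom⁺₁ _ n λ {i} i<n →
    trans (p∘f≡window _) (trans (window-shift a n i) (<ᵇ-true i<n))
  left-out : All (λ x → p x ≡ false) left
  left-out = applyDownFrom⁺₁ _ (suc a) λ i<1+a → trans (p∘f≡window _) (window-below n (≤-pred i<1+a))

cellEq-refl : ∀ c → cellEq c c ≡ true
cellEq-refl (i , j) = to T-≡ (from T-∧ (≡⇒≡ᵇ i i refl , ≡⇒≡ᵇ j j refl))

cellEq⇒≡ : ∀ {c d} → cellEq c d ≡ true → c ≡ d
cellEq⇒≡ {i , j} {i′ , j′} eq with to T-∧ (from T-≡ eq)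
... | i≡ᵇi′ , j≡ᵇj′ = cong₂ _,_ (≡ᵇ⇒≡ i i′ i≡ᵇi′) (≡ᵇ⇒≡ j j′ j≡ᵇj′)

position-head : ∀ c xs → position c (c ∷ xs) ≡ 1
position-head c xs rewrite cellEq-refl c = refl

position-++ˡ : ∀ {c xs} ys → c ∈ xs → position c (xs ++ ys) ≡ position c xs
position-++ˡ {c} ys (here refl) rewrite cellEq-refl c = refl
position-++ˡ {c} {x ∷ _} ys (there c∈xs) with cellEq c x
... | true  = refl
... | false = cong suc (position-++ˡ ys c∈xs)

position-++ʳ : ∀ {c} xs ys → All (c ≢_) xs → position c (xs ++ ys) ≡ length xs + position c ys
position-++ʳ     []       ys []           = refl
position-++ʳ {c} (x ∷ xs) ys (c≢x ∷ c∉xs) with cellEq c x in eq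
... | true  = contradiction (cellEq⇒≡ eq) c≢x
... | false = cong suc (position-++ʳ xs ys c∉xs)

column : List ℕ → List ℕ → ℕ → List Cell
column α β j = filter (λ c → T? (inSkew α β c)) (map (λ i → (i , j)) (oneTo (length α)))

row : List ℕ → List ℕ → ℕ → List Cell
row α β i = filter (λ c → T? (inSkew α β c)) (map (λ j → (i , j)) (reverse (oneTo (maxList α))))

cellsBefore : List ℕ → List ℕ → ℕ → ℕ
cellsBefore α β j = length (concatMap (column α β) (oneTo j))

cellsBefore-suc : ∀ α β j → cellsBefore α β (suc j) ≡ cellsBefore α β j + length (column α β (suc j))
cellsBefore-suc α β j = begin
    length (concatMap (column α β) (oneTo (suc j)))
  ≡⟨ cong (length ∘ concatMap (column α β)) (sym (applyUpTo-∷ʳ suc j)) ⟩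
    length (concatMap (column α β) (oneTo j ++ [ suc j ]))
  ≡⟨ cong length (concatMap-++ (column α β) (oneTo j) [ suc j ]) ⟩
    length (concatMap (column α β) (oneTo j) ++ column α β (suc j) ++ [])
  ≡⟨ length-++ (concatMap (column α β) (oneTo j)) ⟩
    cellsBefore α β j + length (column α β (suc j) ++ [])
  ≡⟨ cong (λ xs → cellsBefore α β j + length xs) (++-identityʳ (column α β (suc j))) ⟩
    cellsBefore α β j + length (column α β (suc j)) ∎
  where open ≡-Reasoning

columns-left-of : ∀ α β j → All (λ d → proj₂ d ≤ j) (concatMap (column α β) (oneTo j))
columns-left-of α β j = concat⁺ (map⁺ (applyUpTo⁺₁ suc j λ k<j →
  filter⁺ (T? ∘ inSkew α β) (map⁺ (applyUpTo⁺₂ suc (length α) (λ _ → k<j)))))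

Scol-column : ∀ α β {i j} → i < length α → j < maxList α → T (inSkew α β (suc i , suc j)) →
  Scol α β (suc i , suc j) ≡ cellsBefore α β j + position (suc i , suc j) (column α β (suc j))
Scol-column α β {i} {j} i<len j<max c∈α/β with m≤n⇒∃[o]m+o≡n j<max
... | r , j+1+r≡max = begin
    position c (concatMap (column α β) (oneTo (maxList α)))
  ≡⟨ cong (position c ∘ concatMap (column α β)) (trans (cong oneTo (sym (trans (+-suc j r) j+1+r≡max))) (applyUpTo-+ suc j r)) ⟩
    position c (concatMap (column α β) (oneTo j ++ suc j ∷ later))
  ≡⟨ cong (position c) (concatMap-++ (column α β) (oneTo j) (suc j ∷ later)) ⟩
    position c (concatMap (column α β) (oneTo j) ++ column α β (suc j) ++ concatMap (column α β) later)
  ≡⟨ position-++ʳ (concatMap (column α β) (oneTo j)) _ (All.map left≢c (columns-left-of α β j)) ⟩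
    cellsBefore α β j + position c (column α β (suc j) ++ concatMap (column α β) later)
  ≡⟨ cong (cellsBefore α β j +_) (position-++ˡ _ c∈column) ⟩
    cellsBefore α β j + position c (column α β (suc j)) ∎
  where
  open ≡-Reasoning
  c : Cell
  c = (suc i , suc j)
  later : List ℕ
  later = applyUpTo (λ k → suc (suc (j + k))) r
  left≢c : ∀ {d} → proj₂ d ≤ j → c ≢ d
  left≢c d≤j refl = 1+n≰n d≤j
  c∈column : c ∈ column α β (suc j)
  c∈column = ∈-filter⁺ (T? ∘ inSkew α β) (∈-map⁺ (λ i → (i , suc j)) (∈-applyUpTo⁺ suc i<len)) c∈α/β

row-interval : ∀ α β i a n k → rowLen β i ≡ suc a → rowLen α i ≡ suc a + n → suc a + n + k ≡ maxList α →
  row α β i ≡ applyDownFrom (λ t → (i , suc (suc a + t))) n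
row-interval α β i a n k βᵢ αᵢ size = begin
    filterᵇ (inSkew α β) (map (i ,_) (reverse (oneTo (maxList α))))
  ≡⟨ cong (λ m → filterᵇ (inSkew α β) (map (i ,_) (reverse (oneTo m)))) (sym size) ⟩
    filterᵇ (inSkew α β) (map (i ,_) (reverse (oneTo (suc a + n + k))))
  ≡⟨ cong (filterᵇ (inSkew α β)) (trans (cong (map (i ,_)) (reverse-applyUpTo suc _)) (map-applyDownFrom suc (i ,_) _)) ⟩
    filterᵇ (inSkew α β) (applyDownFrom (λ j → (i , suc j)) (suc a + n + k))
  ≡⟨ filterᵇ-window (inSkew α β) (λ j → (i , suc j)) a n k inSkew≡window ⟩
    applyDownFrom (λ t → (i , suc (suc a + t))) n ∎
  where
  open ≡-Reasoning
  inSkew≡window : ∀ j → inSkew α β (i , suc j) ≡ window a n j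
  inSkew≡window j rewrite βᵢ | αᵢ = refl

countBelow : ℕ → List ℕ → ℕ
countBelow x ys = length (filterᵇ (_<ᵇ x) ys)

crossInversions : List ℕ → List ℕ → ℕ
crossInversions []       ys = 0
crossInversions (x ∷ xs) ys = countBelow x ys + crossInversions xs ys

countBelow-∷ : ∀ x y ys → countBelow x (y ∷ ys) ≡ toℕ (y <ᵇ x) + countBelow x ys
countBelow-∷ x y ys with y <ᵇ x
... | true  = refl
... | false = refl

countBelow-++ : ∀ x ys zs → countBelow x (ys ++ zs) ≡ countBelow x ys + countBelow x zs
countBelow-++ x ys zs = trans (cong length (filter-++ (T? ∘ (_<ᵇ x)) ys zs)) (length-++ (filterᵇ (_<ᵇ x) ys))

crossInversions-++ʳ : ∀ xs ys zs → crossInversions xs (ys ++ zs) ≡ crossInversions xs ys + crossInversions xs zs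
crossInversions-++ʳ []       ys zs = refl
crossInversions-++ʳ (x ∷ xs) ys zs = begin
    countBelow x (ys ++ zs) + crossInversions xs (ys ++ zs)
  ≡⟨ cong₂ _+_ (countBelow-++ x ys zs) (crossInversions-++ʳ xs ys zs) ⟩
    countBelow x ys + countBelow x zs + (crossInversions xs ys + crossInversions xs zs)
  ≡⟨ interchange (countBelow x ys) (countBelow x zs) (crossInversions xs ys) (crossInversions xs zs) ⟩
    countBelow x ys + crossInversions xs ys + (countBelow x zs + crossInversions xs zs) ∎
  where
  open ≡-Reasoning
  interchange : ∀ a b c d → a + b + (c + d) ≡ a + c + (b + d)
  interchange = solve-∀

inversions-++ : ∀ xs ys → inversions (xs ++ ys) ≡ inversions xs + inversions ys + crossInversions xs ys
inversions-++ []       ys = sym (+-identityʳ (inversions ys))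
inversions-++ (x ∷ xs) ys = begin
    countBelow x (xs ++ ys) + inversions (xs ++ ys)
  ≡⟨ cong₂ _+_ (countBelow-++ x xs ys) (inversions-++ xs ys) ⟩
    countBelow x xs + countBelow x ys + (inversions xs + inversions ys + crossInversions xs ys)
  ≡⟨ regroup (countBelow x xs) (countBelow x ys) (inversions xs) (inversions ys) (crossInversions xs ys) ⟩
    countBelow x xs + inversions xs + inversions ys + (countBelow x ys + crossInversions xs ys) ∎
  where
  open ≡-Reasoning
  regroup : ∀ a b c d e → a + b + (c + d + e) ≡ a + c + d + (b + e)
  regroup = solve-∀

[1+n]C2≡n+nC2 : ∀ n → suc n C 2 ≡ n + n C 2
[1+n]C2≡n+nC2 n = trans (sym (nCk+nC[k+1]≡[n+1]C[k+1] n 1)) (cong (_+ n C 2) (nC1≡n n))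

n+2[nC2]≡n*n : ∀ n → n + (n C 2 + n C 2) ≡ n * n
n+2[nC2]≡n*n zero    = refl
n+2[nC2]≡n*n (suc n) = begin
    suc n + (suc n C 2 + suc n C 2)
  ≡⟨ cong (λ x → suc n + (x + x)) ([1+n]C2≡n+nC2 n) ⟩
    suc n + ((n + n C 2) + (n + n C 2))
  ≡⟨ regroup n (n C 2) ⟩
    suc (n + n) + (n + (n C 2 + n C 2))
  ≡⟨ cong (suc (n + n) +_) (n+2[nC2]≡n*n n) ⟩
    suc (n + n) + n * n
  ≡⟨ square n ⟩
    suc n * suc n ∎
  where
  open ≡-Reasoning
  regroup : ∀ n c → suc n + ((n + c) + (n + c)) ≡ suc (n + n) + (n + (c + c))
  regroup = solve-∀
  square : ∀ n → suc (n + n) + n * n ≡ suc n * suc n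
  square = solve-∀

sumBelow : ℕ → (ℕ → ℕ) → ℕ
sumBelow zero    f = 0
sumBelow (suc n) f = f n + sumBelow n f

sumBelow-cong : ∀ {f g} n → (∀ {k} → k < n → f k ≡ g k) → sumBelow n f ≡ sumBelow n g
sumBelow-cong zero    f≗g = refl
sumBelow-cong (suc n) f≗g = cong₂ _+_ (f≗g (n<1+n n)) (sumBelow-cong n (f≗g ∘ m<n⇒m<1+n))

sumBelow-const : ∀ n v → sumBelow n (λ _ → v) ≡ n * v
sumBelow-const zero    v = refl
sumBelow-const (suc n) v = cong (v +_) (sumBelow-const n v)

sumBelow-suc : ∀ n → sumBelow n suc ≡ n + n C 2
sumBelow-suc zero    = refl
sumBelow-suc (suc n) = cong (suc n +_) (trans (sumBelow-suc n) (sym ([1+n]C2≡n+nC2 n)))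

sumBelow-+ : ∀ f m n → sumBelow (m + n) f ≡ sumBelow m f + sumBelow n (λ k → f (m + k))
sumBelow-+ f m zero    rewrite +-identityʳ m = sym (+-identityʳ (sumBelow m f))
sumBelow-+ f m (suc n) rewrite +-suc m n | sumBelow-+ f m n = +-comm-middle (f (m + n)) (sumBelow m f) _
  where
  +-comm-middle : ∀ a b c → a + (b + c) ≡ b + (a + c)
  +-comm-middle = solve-∀

crossInversions-applyDownFrom : ∀ f n ys → crossInversions (applyDownFrom f n) ys ≡ sumBelow n (λ k → countBelow (f k) ys)
crossInversions-applyDownFrom f zero    ys = refl
crossInversions-applyDownFrom f (suc n) ys = cong (countBelow (f n) ys +_) (crossInversions-applyDownFrom f n ys)

countBelow-applyDownFrom : ∀ x f t n → (∀ {i} → i < n → (f i <ᵇ x) ≡ (i <ᵇ t)) → countBelow x (applyDownFrom f n) ≡ n ⊓ t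
countBelow-applyDownFrom x f t zero    threshold = refl
countBelow-applyDownFrom x f t (suc n) threshold = begin
    countBelow x (f n ∷ applyDownFrom f n)
  ≡⟨ countBelow-∷ x (f n) (applyDownFrom f n) ⟩
    toℕ (f n <ᵇ x) + countBelow x (applyDownFrom f n)
  ≡⟨ cong₂ _+_ (cong toℕ (threshold (n<1+n n))) (countBelow-applyDownFrom x f t n (threshold ∘ m<n⇒m<1+n)) ⟩
    toℕ (n <ᵇ t) + n ⊓ t
  ≡⟨ trans (+-comm _ (n ⊓ t)) (sym (⊓-suc n t)) ⟩
    suc n ⊓ t ∎
  where open ≡-Reasoning

inversions-applyDownFrom : ∀ f n → (∀ {i j} → i < j → f i < f j) → inversions (applyDownFrom f n) ≡ n C 2
inversions-applyDownFrom f zero    f-mono = refl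
inversions-applyDownFrom f (suc n) f-mono = begin
    countBelow (f n) (applyDownFrom f n) + inversions (applyDownFrom f n)
  ≡⟨ cong₂ _+_ (countBelow-applyDownFrom (f n) f n n below) (inversions-applyDownFrom f n f-mono) ⟩
    n ⊓ n + n C 2
  ≡⟨ trans (cong (_+ n C 2) (⊓-idem n)) (sym ([1+n]C2≡n+nC2 n)) ⟩
    suc n C 2 ∎
  where
  open ≡-Reasoning
  below : ∀ {i} → i < n → (f i <ᵇ f n) ≡ (i <ᵇ n)
  below i<n = trans (<ᵇ-true (f-mono i<n)) (sym (<ᵇ-true i<n))

sumBelow-suc⊓+C2 : ∀ c₁ c₂ → sumBelow c₁ (λ k → suc k ⊓ c₂) + c₁ C 2 + c₂ C 2 ≡ c₁ * (c₁ ⊓ c₂) + (c₁ ⊔ c₂) C 2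
sumBelow-suc⊓+C2 c₁ c₂ with ≤-total c₁ c₂
... | inj₁ c₁≤c₂ rewrite m≤n⇒m⊓n≡m c₁≤c₂ | m≤n⇒m⊔n≡n c₁≤c₂ = begin
    sumBelow c₁ (λ k → suc k ⊓ c₂) + c₁ C 2 + c₂ C 2
  ≡⟨ cong (λ s → s + c₁ C 2 + c₂ C 2) (trans (sumBelow-cong c₁ (λ k<c₁ → m≤n⇒m⊓n≡m (≤-trans k<c₁ c₁≤c₂))) (sumBelow-suc c₁)) ⟩
    c₁ + c₁ C 2 + c₁ C 2 + c₂ C 2
  ≡⟨ cong (_+ c₂ C 2) (trans (+-assoc c₁ _ _) (n+2[nC2]≡n*n c₁)) ⟩
    c₁ * c₁ + c₂ C 2 ∎
  where open ≡-Reasoning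
... | inj₂ c₂≤c₁ with m≤n⇒∃[o]m+o≡n c₂≤c₁
...   | d , refl rewrite m≥n⇒m⊓n≡n c₂≤c₁ | m≥n⇒m⊔n≡m c₂≤c₁ = begin
    sumBelow (c₂ + d) (λ k → suc k ⊓ c₂) + (c₂ + d) C 2 + c₂ C 2
  ≡⟨ cong (λ s → s + (c₂ + d) C 2 + c₂ C 2) (sumBelow-+ (λ k → suc k ⊓ c₂) c₂ d) ⟩
    sumBelow c₂ (λ k → suc k ⊓ c₂) + sumBelow d (λ k → suc (c₂ + k) ⊓ c₂) + (c₂ + d) C 2 + c₂ C 2
  ≡⟨ cong₂ (λ s t → s + t + (c₂ + d) C 2 + c₂ C 2)
       (trans (sumBelow-cong c₂ (λ k<c₂ → m≤n⇒m⊓n≡m k<c₂)) (sumBelow-suc c₂))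
       (trans (sumBelow-cong d (λ _ → m≥n⇒m⊓n≡n (m≤n⇒m≤1+n (m≤m+n c₂ _)))) (sumBelow-const d c₂)) ⟩
    c₂ + c₂ C 2 + d * c₂ + (c₂ + d) C 2 + c₂ C 2
  ≡⟨ regroup c₂ d (c₂ C 2) ((c₂ + d) C 2) ⟩
    c₂ + (c₂ C 2 + c₂ C 2) + d * c₂ + (c₂ + d) C 2
  ≡⟨ cong (λ s → s + d * c₂ + (c₂ + d) C 2) (n+2[nC2]≡n*n c₂) ⟩
    c₂ * c₂ + d * c₂ + (c₂ + d) C 2
  ≡⟨ cong (_+ (c₂ + d) C 2) (sym (*-distribʳ-+ c₂ c₂ d)) ⟩
    (c₂ + d) * c₂ + (c₂ + d) C 2 ∎
  where
  open ≡-Reasoning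
  regroup : ∀ c d x y → c + x + d * c + y + x ≡ c + (x + x) + d * c + y
  regroup = solve-∀

module Lobster (b c₁ c₂ : ℕ) where

  α : List ℕ
  α = lobsterα b c₁ c₂

  β : List ℕ
  β = lobsterβ b

  maxList-α : maxList α ≡ suc b + (c₁ ⊔ c₂)
  maxList-α = begin
      (suc b + c₂) ⊔ (suc b ⊔ ((suc b + c₁) ⊔ 0))
    ≡⟨ cong (λ m → (suc b + c₂) ⊔ (suc b ⊔ m)) (⊔-identityʳ (suc b + c₁)) ⟩
      (suc b + c₂) ⊔ (suc b ⊔ (suc b + c₁))
    ≡⟨ cong ((suc b + c₂) ⊔_) (m≤n⇒m⊔n≡n (m≤m+n (suc b) c₁)) ⟩
      (suc b + c₂) ⊔ (suc b + c₁)
    ≡⟨ sym (+-distribˡ-⊔ (suc b) c₂ c₁) ⟩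
      suc b + (c₂ ⊔ c₁)
    ≡⟨ cong (suc b +_) (⊔-comm c₂ c₁) ⟩
      suc b + (c₁ ⊔ c₂) ∎
    where open ≡-Reasoning

  wing : ℕ → ℕ
  wing i = suc (suc b + i)

  wingColumn : ℕ → List Cell
  wingColumn i = (if i <ᵇ c₂ then [ (1 , wing i) ] else []) ++ (if i <ᵇ c₁ then [ (3 , wing i) ] else [])

  column-middle : ∀ {k} → k < b → column α β (suc (suc k)) ≡ [ (2 , suc (suc k)) ]
  column-middle {k} k<b = filterᵇ-cong (inSkew α β) (λ c → proj₁ c ≡ᵇ 2)
    ((1 , suc (suc k)) ∷ (2 , suc (suc k)) ∷ (3 , suc (suc k)) ∷ [])
    (window-below c₂ k<b ∷ trans (window-shift 0 b k) (<ᵇ-true k<b) ∷ window-below c₁ k<b ∷ [])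

  column-wing : ∀ i → column α β (wing i) ≡ wingColumn i
  column-wing i = trans
    (filterᵇ-cong (inSkew α β) (occupied (i <ᵇ c₂) (i <ᵇ c₁)) ((1 , wing i) ∷ (2 , wing i) ∷ (3 , wing i) ∷ [])
      (window-shift b c₂ i ∷ trans (window-shift 0 b (b + i)) (<ᵇ-false (m≤m+n b i)) ∷ window-shift b c₁ i ∷ []))
    by-cases
    where
    occupied : Bool → Bool → Cell → Bool
    occupied bottom top (1 , _) = bottom
    occupied bottom top (3 , _) = top
    occupied bottom top _       = false
    by-cases : filterᵇ (occupied (i <ᵇ c₂) (i <ᵇ c₁)) ((1 , wing i) ∷ (2 , wing i) ∷ (3 , wing i) ∷ []) ≡ wingColumn i
    by-cases with i <ᵇ c₂ | i <ᵇ c₁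
    ... | true  | true  = refl
    ... | true  | false = refl
    ... | false | true  = refl
    ... | false | false = refl

  length-wingColumn : ∀ i → length (wingColumn i) ≡ toℕ (i <ᵇ c₂) + toℕ (i <ᵇ c₁)
  length-wingColumn i with i <ᵇ c₂ | i <ᵇ c₁
  ... | true  | true  = refl
  ... | true  | false = refl
  ... | false | true  = refl
  ... | false | false = refl

  position-bottom : ∀ {i} → i < c₂ → position (1 , wing i) (wingColumn i) ≡ 1
  position-bottom {i} i<c₂ rewrite <ᵇ-true i<c₂ = position-head (1 , wing i) (if i <ᵇ c₁ then [ (3 , wing i) ] else [])

  position-top : ∀ {i} → i < c₁ → position (3 , wing i) (wingColumn i) ≡ suc (toℕ (i <ᵇ c₂))
  position-top {i} i<c₁ rewrite <ᵇ-true i<c₁ with i <ᵇ c₂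
  ... | true  rewrite cellEq-refl (3 , wing i) = refl
  ... | false rewrite cellEq-refl (3 , wing i) = refl

  cellsBefore-middle : ∀ {k} → k ≤ b → cellsBefore α β (suc k) ≡ k
  cellsBefore-middle {zero}  _   = refl
  cellsBefore-middle {suc k} k<b = begin
      cellsBefore α β (suc (suc k))
    ≡⟨ cellsBefore-suc α β (suc k) ⟩
      cellsBefore α β (suc k) + length (column α β (suc (suc k)))
    ≡⟨ cong₂ _+_ (cellsBefore-middle (<⇒≤ k<b)) (cong length (column-middle k<b)) ⟩
      k + 1
    ≡⟨ +-comm k 1 ⟩
      suc k ∎
    where open ≡-Reasoning

  cellsBefore-wing : ∀ i → cellsBefore α β (suc b + i) ≡ b + (i ⊓ c₂ + i ⊓ c₁)
  cellsBefore-wing zero    = begin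
      cellsBefore α β (suc b + 0)  ≡⟨ cong (cellsBefore α β) (+-identityʳ (suc b)) ⟩
      cellsBefore α β (suc b)      ≡⟨ cellsBefore-middle ≤-refl ⟩
      b                            ≡⟨ +-identityʳ b ⟨
      b + 0                        ∎
    where open ≡-Reasoning
  cellsBefore-wing (suc i) = begin
      cellsBefore α β (suc b + suc i)
    ≡⟨ cong (cellsBefore α β) (+-suc (suc b) i) ⟩
      cellsBefore α β (wing i)
    ≡⟨ cellsBefore-suc α β (suc b + i) ⟩
      cellsBefore α β (suc b + i) + length (column α β (wing i))
    ≡⟨ cong₂ _+_ (cellsBefore-wing i) (trans (cong length (column-wing i)) (length-wingColumn i)) ⟩
      b + (i ⊓ c₂ + i ⊓ c₁) + (toℕ (i <ᵇ c₂) + toℕ (i <ᵇ c₁))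
    ≡⟨ regroup b (i ⊓ c₂) (i ⊓ c₁) (toℕ (i <ᵇ c₂)) (toℕ (i <ᵇ c₁)) ⟩
      b + ((i ⊓ c₂ + toℕ (i <ᵇ c₂)) + (i ⊓ c₁ + toℕ (i <ᵇ c₁)))
    ≡⟨ cong₂ (λ x y → b + (x + y)) (⊓-suc i c₂) (⊓-suc i c₁) ⟨
      b + (suc i ⊓ c₂ + suc i ⊓ c₁) ∎
    where
    open ≡-Reasoning
    regroup : ∀ b x y u v → b + (x + y) + (u + v) ≡ b + ((x + u) + (y + v))
    regroup = solve-∀

  topEntry bottomEntry : ℕ → ℕ
  topEntry    i = suc (b + i + suc i ⊓ c₂)
  bottomEntry i = suc (b + i + i ⊓ c₁)

  wing<maxList : ∀ {i} → i < c₁ ⊔ c₂ → suc b + i < maxList α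
  wing<maxList {i} i<K = subst (suc b + i <_) (sym maxList-α) (+-monoʳ-< (suc b) i<K)

  Scol-middle : ∀ {k} → k < b → Scol α β (2 , suc (suc k)) ≡ suc k
  Scol-middle {k} k<b = begin
      Scol α β (2 , suc (suc k))
    ≡⟨ Scol-column α β (s≤s (s≤s z≤n)) middle<maxList (window-inside 0 k<b) ⟩
      cellsBefore α β (suc k) + position (2 , suc (suc k)) (column α β (suc (suc k)))
    ≡⟨ cong₂ _+_ (cellsBefore-middle (<⇒≤ k<b)) (trans (cong (position _) (column-middle k<b)) (position-head (2 , suc (suc k)) [])) ⟩
      k + 1
    ≡⟨ +-comm k 1 ⟩
      suc k ∎
    where
    open ≡-Reasoning
    middle<maxList : suc k < maxList α
    middle<maxList = subst (suc k <_) (sym maxList-α) (s≤s (≤-trans k<b (m≤m+n b (c₁ ⊔ c₂))))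

  Scol-top : ∀ {i} → i < c₁ → Scol α β (3 , wing i) ≡ topEntry i
  Scol-top {i} i<c₁ = begin
      Scol α β (3 , wing i)
    ≡⟨ Scol-column α β (s≤s (s≤s (s≤s z≤n))) (wing<maxList (≤-trans i<c₁ (m≤m⊔n c₁ c₂))) (window-inside b i<c₁) ⟩
      cellsBefore α β (suc b + i) + position (3 , wing i) (column α β (wing i))
    ≡⟨ cong₂ _+_ (cellsBefore-wing i) (trans (cong (position _) (column-wing i)) (position-top i<c₁)) ⟩
      b + (i ⊓ c₂ + i ⊓ c₁) + suc (toℕ (i <ᵇ c₂))
    ≡⟨ cong (λ m → b + (i ⊓ c₂ + m) + suc (toℕ (i <ᵇ c₂))) (m≤n⇒m⊓n≡m (<⇒≤ i<c₁)) ⟩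
      b + (i ⊓ c₂ + i) + suc (toℕ (i <ᵇ c₂))
    ≡⟨ regroup b i (i ⊓ c₂) (toℕ (i <ᵇ c₂)) ⟩
      suc (b + i + (i ⊓ c₂ + toℕ (i <ᵇ c₂)))
    ≡⟨ cong (λ m → suc (b + i + m)) (⊓-suc i c₂) ⟨
      topEntry i ∎
    where
    open ≡-Reasoning
    regroup : ∀ b i m t → b + (m + i) + suc t ≡ suc (b + i + (m + t))
    regroup = solve-∀

  Scol-bottom : ∀ {i} → i < c₂ → Scol α β (1 , wing i) ≡ bottomEntry i
  Scol-bottom {i} i<c₂ = begin
      Scol α β (1 , wing i)
    ≡⟨ Scol-column α β (s≤s z≤n) (wing<maxList (≤-trans i<c₂ (m≤n⊔m c₁ c₂))) (window-inside b i<c₂) ⟩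
      cellsBefore α β (suc b + i) + position (1 , wing i) (column α β (wing i))
    ≡⟨ cong₂ _+_ (cellsBefore-wing i) (trans (cong (position _) (column-wing i)) (position-bottom i<c₂)) ⟩
      b + (i ⊓ c₂ + i ⊓ c₁) + 1
    ≡⟨ cong (λ m → b + (m + i ⊓ c₁) + 1) (m≤n⇒m⊓n≡m (<⇒≤ i<c₂)) ⟩
      b + (i + i ⊓ c₁) + 1
    ≡⟨ regroup b i (i ⊓ c₁) ⟩
      bottomEntry i ∎
    where
    open ≡-Reasoning
    regroup : ∀ b i m → b + (i + m) + 1 ≡ suc (b + i + m)
    regroup = solve-∀

  row-wing : ∀ r c → rowLen β r ≡ suc b → rowLen α r ≡ suc b + c → c ≤ c₁ ⊔ c₂ →
    row α β r ≡ applyDownFrom (λ i → (r , wing i)) c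
  row-wing r c βᵣ αᵣ c≤K with m≤n⇒∃[o]m+o≡n c≤K
  ... | e , c+e≡K = row-interval α β r b c e βᵣ αᵣ
    (trans (+-assoc (suc b) c e) (trans (cong (suc b +_) c+e≡K) (sym maxList-α)))

  topRow middleRow bottomRow : List Cell
  topRow    = applyDownFrom (λ i → (3 , wing i)) c₁
  middleRow = applyDownFrom (λ k → (2 , suc (suc k))) b
  bottomRow = applyDownFrom (λ i → (1 , wing i)) c₂

  readingOrder-lobster : readingOrder α β ≡ topRow ++ middleRow ++ bottomRow
  readingOrder-lobster = cong₂ _++_ (row-wing 3 c₁ refl refl (m≤m⊔n c₁ c₂))
    (cong₂ _++_ (row-interval α β 2 0 b (c₁ ⊔ c₂) refl refl (sym maxList-α))
      (trans (++-identityʳ (row α β 1)) (row-wing 1 c₂ refl refl (m≤n⊔m c₁ c₂))))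

  readingWord-lobster : readingWord α β (Scol α β) ≡
    applyDownFrom topEntry c₁ ++ applyDownFrom suc b ++ applyDownFrom bottomEntry c₂
  readingWord-lobster = begin
      map S (readingOrder α β)
    ≡⟨ cong (map S) readingOrder-lobster ⟩
      map S (topRow ++ middleRow ++ bottomRow)
    ≡⟨ trans (map-++ S topRow _) (cong (map S topRow ++_) (map-++ S middleRow bottomRow)) ⟩
      map S topRow ++ map S middleRow ++ map S bottomRow
    ≡⟨ cong₂ _++_ (entries c₁ Scol-top) (cong₂ _++_ (entries b Scol-middle) (entries c₂ Scol-bottom)) ⟩
      applyDownFrom topEntry c₁ ++ applyDownFrom suc b ++ applyDownFrom bottomEntry c₂ ∎
    where
    open ≡-Reasoning
    S : Tableau
    S = Scol α β
    entries : ∀ {f g} n → (∀ {i} → i < n → S (f i) ≡ g i) → map S (applyDownFrom f n) ≡ applyDownFrom g n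
    entries {f} n S∘f≗g = trans (map-applyDownFrom f S n) (applyDownFrom-cong n S∘f≗g)

  topEntry-mono : ∀ {i j} → i < j → topEntry i < topEntry j
  topEntry-mono i<j = s≤s (+-mono-<-≤ (+-monoʳ-< b i<j) (⊓-monoˡ-≤ c₂ (s≤s (<⇒≤ i<j))))

  bottomEntry-mono : ∀ {i j} → i < j → bottomEntry i < bottomEntry j
  bottomEntry-mono i<j = s≤s (+-mono-<-≤ (+-monoʳ-< b i<j) (⊓-monoˡ-≤ c₁ (<⇒≤ i<j)))

  b<bottomEntry : ∀ i → b < bottomEntry i
  b<bottomEntry i = s≤s (≤-trans (m≤m+n b i) (m≤m+n (b + i) (i ⊓ c₁)))

  crossInversions-top-middle : crossInversions (applyDownFrom topEntry c₁) (applyDownFrom suc b) ≡ c₁ * b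
  crossInversions-top-middle = begin
      crossInversions (applyDownFrom topEntry c₁) (applyDownFrom suc b)
    ≡⟨ crossInversions-applyDownFrom topEntry c₁ _ ⟩
      sumBelow c₁ (λ k → countBelow (topEntry k) (applyDownFrom suc b))
    ≡⟨ sumBelow-cong c₁ (λ {k} _ → trans (countBelow-applyDownFrom (topEntry k) suc b b (all-below k)) (⊓-idem b)) ⟩
      sumBelow c₁ (λ _ → b)
    ≡⟨ sumBelow-const c₁ b ⟩
      c₁ * b ∎
    where
    open ≡-Reasoning
    all-below : ∀ k {i} → i < b → (suc i <ᵇ topEntry k) ≡ (i <ᵇ b)
    all-below k i<b = trans (<ᵇ-true (s≤s (≤-trans i<b (≤-trans (m≤m+n b k) (m≤m+n (b + k) _)))))
                            (sym (<ᵇ-true i<b))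

  crossInversions-middle-bottom : crossInversions (applyDownFrom suc b) (applyDownFrom bottomEntry c₂) ≡ 0
  crossInversions-middle-bottom = begin
      crossInversions (applyDownFrom suc b) (applyDownFrom bottomEntry c₂)
    ≡⟨ crossInversions-applyDownFrom suc b _ ⟩
      sumBelow b (λ k → countBelow (suc k) (applyDownFrom bottomEntry c₂))
    ≡⟨ sumBelow-cong b (λ k<b → trans (countBelow-applyDownFrom (suc _) bottomEntry 0 c₂ (none-below k<b)) (⊓-zeroʳ c₂)) ⟩
      sumBelow b (λ _ → 0)
    ≡⟨ trans (sumBelow-const b 0) (*-zeroʳ b) ⟩
      0 ∎
    where
    open ≡-Reasoning
    none-below : ∀ {k} → k < b → ∀ {i} → i < c₂ → (bottomEntry i <ᵇ suc k) ≡ (i <ᵇ 0)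
    none-below k<b {i} _ = <ᵇ-false (≤-trans k<b (<⇒≤ (b<bottomEntry i)))

  countBelow-topEntry : ∀ {k} → k < c₁ → countBelow (topEntry k) (applyDownFrom bottomEntry c₂) ≡ suc k ⊓ c₂
  countBelow-topEntry {k} k<c₁ =
    trans (countBelow-applyDownFrom (topEntry k) bottomEntry (suc k) c₂ compare) (⊓-comm c₂ (suc k))
    where
    compare : ∀ {i} → i < c₂ → (bottomEntry i <ᵇ topEntry k) ≡ (i <ᵇ suc k)
    compare {i} i<c₂ with ≤-<-connex i k
    ... | inj₁ i≤k = trans (<ᵇ-true (s≤s (+-mono-≤-< (+-monoʳ-≤ b i≤k) (≤-<-trans (m⊓n≤m i c₁) (⊓-glb (s≤s i≤k) i<c₂)))))
                           (sym (<ᵇ-true (s≤s i≤k)))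
    ... | inj₂ k<i = trans (<ᵇ-false (s≤s (+-mono-≤ (+-monoʳ-≤ b (<⇒≤ k<i)) (≤-trans (m⊓n≤m (suc k) c₂) (⊓-glb k<i k<c₁)))))
                           (sym (<ᵇ-false k<i))

  inversions-readingWord :
    inversions (applyDownFrom topEntry c₁ ++ applyDownFrom suc b ++ applyDownFrom bottomEntry c₂) ≡
    c₁ C 2 + (b C 2 + c₂ C 2 + 0) + (c₁ * b + sumBelow c₁ (λ k → suc k ⊓ c₂))
  inversions-readingWord = begin
      inversions (top ++ middle ++ bottom)
    ≡⟨ inversions-++ top (middle ++ bottom) ⟩
      inversions top + inversions (middle ++ bottom) + crossInversions top (middle ++ bottom)
    ≡⟨ cong₂ (λ x y → inversions top + x + y) (inversions-++ middle bottom) (crossInversions-++ʳ top middle bottom) ⟩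
      inversions top + (inversions middle + inversions bottom + crossInversions middle bottom)
        + (crossInversions top middle + crossInversions top bottom)
    ≡⟨ cong₂ _+_
         (cong₂ _+_ (inversions-applyDownFrom topEntry c₁ topEntry-mono)
           (cong₂ _+_ (cong₂ _+_ (inversions-applyDownFrom suc b s≤s) (inversions-applyDownFrom bottomEntry c₂ bottomEntry-mono))
             crossInversions-middle-bottom))
         (cong₂ _+_ crossInversions-top-middle
           (trans (crossInversions-applyDownFrom topEntry c₁ bottom) (sumBelow-cong c₁ countBelow-topEntry))) ⟩
      c₁ C 2 + (b C 2 + c₂ C 2 + 0) + (c₁ * b + sumBelow c₁ (λ k → suc k ⊓ c₂)) ∎
    where
    open ≡-Reasoning
    top middle bottom : List ℕ
    top    = applyDownFrom topEntry c₁
    middle = applyDownFrom suc b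
    bottom = applyDownFrom bottomEntry c₂

lemma23 : (b c₁ c₂ : ℕ) → 1 ≤ b → 1 ≤ c₁ → 1 ≤ c₂ →
    inv (lobsterα b c₁ c₂) (lobsterβ b) (Scol (lobsterα b c₁ c₂) (lobsterβ b))
      ≡ c₁ * (b + (c₁ ⊓ c₂)) + b C 2 + (c₁ ⊔ c₂) C 2
lemma23 b c₁ c₂ _ _ _ = begin
    inversions (readingWord α β (Scol α β))
  ≡⟨ cong inversions readingWord-lobster ⟩
    inversions (applyDownFrom topEntry c₁ ++ applyDownFrom suc b ++ applyDownFrom bottomEntry c₂)
  ≡⟨ inversions-readingWord ⟩
    c₁ C 2 + (b C 2 + c₂ C 2 + 0) + (c₁ * b + sumBelow c₁ (λ k → suc k ⊓ c₂))
  ≡⟨ regroup (c₁ C 2) (b C 2) (c₂ C 2) (c₁ * b) (sumBelow c₁ (λ k → suc k ⊓ c₂)) ⟩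
    c₁ * b + b C 2 + (sumBelow c₁ (λ k → suc k ⊓ c₂) + c₁ C 2 + c₂ C 2)
  ≡⟨ cong (c₁ * b + b C 2 +_) (sumBelow-suc⊓+C2 c₁ c₂) ⟩
    c₁ * b + b C 2 + (c₁ * (c₁ ⊓ c₂) + (c₁ ⊔ c₂) C 2)
  ≡⟨ distribute c₁ b (c₁ ⊓ c₂) (b C 2) ((c₁ ⊔ c₂) C 2) ⟩
    c₁ * (b + (c₁ ⊓ c₂)) + b C 2 + (c₁ ⊔ c₂) C 2 ∎
  where
  open ≡-Reasoning
  open Lobster b c₁ c₂
  regroup : ∀ x y z p s → x + (y + z + 0) + (p + s) ≡ p + y + (s + x + z)
  regroup = solve-∀
  distribute : ∀ c b m y z → c * b + y + (c * m + z) ≡ c * (b + m) + y + z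
  distribute = solve-∀
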